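{- Let $\mathcal H_{\mathbb Z}=\bigoplus_{n\ge 0} D_n$ be graded by depth, as described in the context. There is a unique associative product $\sqcup\!\sqcup$ on $\mathcal H_{\mathbb Z}$ with the following properties: <ul> <li>it is graded, i.e. $D_n\sqcup\!\sqcup D_m\subseteq D_{n+m}$;</li> <li>it has unit $\mathbf 1$;</li> <li>$[0]\sqcup\!\sqcup[\vec s]=[0,\vec s]$ for all $k\ge 1$ and $\vec s\in\mathbb Z^k$;</li> <li>$[\vec s]\sqcup\!\sqcup[0]=[0,\vec s]$ for all $k\ge 1$ and $\vec s\in\mathbb Z_{>0}\times\mathbb Z^{k-1}$;</li> <li>$J$ is a differential operator with respect to $\sqcup\!\sqcup$, i.e. $J(a\sqcup\!\sqcup b)=J(a)\sqcup\!\sqcup b+a\sqcup\!\sqcup J(b)$ for all $a,b\in\mathcal H_{\mathbb Z}$.</li> </ul>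
   Context: Let $\mathcal H_{\mathbb Z}$ be the $\mathbb Q$-vector space with basis consisting of a symbol $\mathbf 1$ together with the formal symbols $[s_1,\dots,s_k]$ for all $k\ge 1$ and $(s_1,\dots,s_k)\in\mathbb Z^k$. These symbols carry no componentwise structure. The depth of $[s_1,\dots,s_k]$ is $k$, and the depth of $\mathbf 1$ is $0$. Let $D_n$ be the span of the basis elements of depth $n$, so $D_0=\mathbb Q\mathbf 1$. For $\vec s=(s_1,\dots,s_k)$ and $a\in\mathbb Z$, write $[a,\vec s]:=[a,s_1,\dots,s_k]$. Let $J:\mathcal H_{\mathbb Z}\to\mathcal H_{\mathbb Z}$ be the linear map given by $J([s_1,s_2,\dots,s_k])=[s_1-1,s_2,\dots,s_k]$ for $k\ge1$, and $J(\mathbf 1)=0$. -}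

module Defs where

open import Data.Nat using (ℕ)
open import Data.Integer as ℤ using (ℤ; _>_)
open import Data.Rational as ℚ using (ℚ)
open import Data.List using (List; []; _∷_; _++_; map; length; concatMap)
open import Data.List.Properties using (≡-dec)
open import Data.Product using (_×_; _,_; Σ)
open import Relation.Binary.PropositionalEquality using (_≡_; _≢_)
open import Relation.Nullary using (yes; no)

-- A basis word: [] stands for the symbol 𝟏, (s₁ ∷ … ∷ sₖ) for [s₁,…,sₖ].
Word : Set
Word = List ℤ

depth : Word → ℕ
depth = length

-- Elements of ℋ_ℤ: finite formal ℚ-linear combinations of basis words.
H : Set
H = List (ℚ × Word)

_≟w_ : (u v : Word) → Relation.Nullary.Dec (u ≡ v)
_≟w_ = ≡-dec ℤ._≟_

coeff : H → Word → ℚ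
coeff [] w = ℚ.0ℚ
coeff ((q , u) ∷ xs) w with u ≟w w
... | yes _ = q ℚ.+ coeff xs w
... | no  _ = coeff xs w

infix 4 _≈_
_≈_ : H → H → Set
x ≈ y = ∀ w → coeff x w ≡ coeff y w

infixl 6 _⊕_
_⊕_ : H → H → H
x ⊕ y = x ++ y

infixr 7 _·_
_·_ : ℚ → H → H
c · x = map (λ { (q , u) → (c ℚ.* q , u) }) x

⟦_⟧ : Word → H
⟦ w ⟧ = (ℚ.1ℚ , w) ∷ []

𝟏 : H
𝟏 = ⟦ [] ⟧

InD : ℕ → H → Set
InD n x = ∀ w → depth w ≢ n → coeff x w ≡ ℚ.0ℚ

J : H → H
J = concatMap step
  where
  step : ℚ × Word → H
  step (q , []) = []
  step (q , s ∷ ss) = (q , (s ℤ.- ℤ.1ℤ) ∷ ss) ∷ []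

record IsProduct (_⧢_ : H → H → H) : Set where
  field
    ⧢-cong  : ∀ {a a′ b b′} → a ≈ a′ → b ≈ b′ → (a ⧢ b) ≈ (a′ ⧢ b′)
    ⧢-addˡ  : ∀ a a′ b → ((a ⊕ a′) ⧢ b) ≈ ((a ⧢ b) ⊕ (a′ ⧢ b))
    ⧢-addʳ  : ∀ a b b′ → (a ⧢ (b ⊕ b′)) ≈ ((a ⧢ b) ⊕ (a ⧢ b′))
    ⧢-scaleˡ : ∀ c a b → ((c · a) ⧢ b) ≈ (c · (a ⧢ b))
    ⧢-scaleʳ : ∀ c a b → (a ⧢ (c · b)) ≈ (c · (a ⧢ b))
    ⧢-assoc : ∀ a b c → ((a ⧢ b) ⧢ c) ≈ (a ⧢ (b ⧢ c))
    ⧢-graded : ∀ n m a b → InD n a → InD m b → InD (n Data.Nat.+ m) (a ⧢ b)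
    ⧢-unitˡ : ∀ a → (𝟏 ⧢ a) ≈ a
    ⧢-unitʳ : ∀ a → (a ⧢ 𝟏) ≈ a
    ⧢-zeroˡ : ∀ s ss → (⟦ ℤ.0ℤ ∷ [] ⟧ ⧢ ⟦ s ∷ ss ⟧) ≈ ⟦ ℤ.0ℤ ∷ s ∷ ss ⟧
    ⧢-zeroʳ : ∀ s ss → s > ℤ.0ℤ → (⟦ s ∷ ss ⟧ ⧢ ⟦ ℤ.0ℤ ∷ [] ⟧) ≈ ⟦ ℤ.0ℤ ∷ s ∷ ss ⟧
    J-leibniz : ∀ a b → J (a ⧢ b) ≈ ((J a ⧢ b) ⊕ (a ⧢ J b))

{-# OPTIONS --safe #-}
module Submission where

-- J lowers the first letter of a word, so for words [a, u] and [b, v] the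
-- Leibniz rule relates products at neighbouring points of the plane of first
-- letters: J([a,u] ⧢ [b,v]) = [a-1,u] ⧢ [b,v] + [a,u] ⧢ [b-1,v].  Unit,
-- associativity and the two zero rules force [0,u] ⧢ y = [0, u ⧢ y] and
-- [a,u] ⧢ [0,v] = [0, [a,u] ⧢ v] for a > 0.  These boundary values, together
-- with the injectivity of J on vectors without 𝟏-component, determine the
-- product of two words by induction on their lengths and then on the first
-- letters, which gives uniqueness.  Read as a definition, the same recursion
-- produces a bilinear, graded product satisfying the Leibniz rule; it is
-- associative because (x ⧢ y) ⧢ z and x ⧢ (y ⧢ z) both solve the
-- three-variable version of the recursion, whose solutions are unique too.

open import Defs
open import Algebra.Bundles using (AbelianGroup)
import Algebra.Properties.AbelianGroup as AbelianGroupProperties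
import Algebra.Properties.CommutativeSemigroup as CommutativeSemigroupProperties
import Algebra.Properties.Group as GroupProperties
open import Data.Empty using (⊥)
open import Data.Integer as ℤ using (ℤ; +_; -[1+_]; +[1+_]; 0ℤ; 1ℤ)
import Data.Integer.Properties as ℤP
open import Data.List using ([]; _∷_; map; length; filter)
open import Data.List.Properties using (∷-injectiveˡ; ∷-injectiveʳ)
import Data.List.Properties as ListP
open import Data.List.Relation.Unary.Any using (here)
open import Data.Nat as ℕ using (ℕ; zero; suc)
open import Data.Nat.Induction using (<-wellFounded)
import Data.Nat.Properties as ℕP
open import Data.Product using (Σ; _×_; _,_; proj₂; map₁; map₂)
open import Data.Rational as ℚ using (0ℚ; 1ℚ)
import Data.Rational.Properties as ℚP
open import Data.Sum using (_⊎_; inj₁; inj₂)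
open import Data.Unit using (⊤; tt)
open import Data.Vec using (Vec; []; _∷_)
open import Data.Vec.Relation.Unary.All using (All; []; _∷_)
open import Function using (case_of_)
open import Induction.WellFounded using (Acc; acc)
open import Relation.Binary.PropositionalEquality
  using (_≡_; _≢_; refl; sym; trans; cong; cong₂; subst; module ≡-Reasoning)
import Relation.Binary.Reasoning.Setoid as SetoidReasoning
open import Relation.Nullary using (yes; no; ¬_; ¬?; contradiction)
open import Relation.Unary using (Decidable)

-- Linear algebra in ℋ_ℤ

infix 4 _≋_

-- Defs' _≈_ is a Π-type, from which Agda cannot infer the two vectors;
-- wrapped in a record they become inferable.
record _≋_ (x y : H) : Set where
  constructor pointwise
  field coeff-≡ : x ≈ y
open _≋_

neg : H → H
neg = map (map₁ (ℚ.-_))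

coeff-⊕ : ∀ x y w → coeff (x ⊕ y) w ≡ coeff x w ℚ.+ coeff y w
coeff-⊕ []            y w = sym (ℚP.+-identityˡ _)
coeff-⊕ ((q , u) ∷ x) y w with u ≟w w
... | yes _ = trans (cong (q ℚ.+_) (coeff-⊕ x y w)) (sym (ℚP.+-assoc q _ _))
... | no  _ = coeff-⊕ x y w

coeff-· : ∀ c x w → coeff (c · x) w ≡ c ℚ.* coeff x w
coeff-· c []            w = sym (ℚP.*-zeroʳ c)
coeff-· c ((q , u) ∷ x) w with u ≟w w
... | yes _ = trans (cong (c ℚ.* q ℚ.+_) (coeff-· c x w)) (sym (ℚP.*-distribˡ-+ c q _))
... | no  _ = coeff-· c x w

coeff-neg : ∀ x w → coeff (neg x) w ≡ ℚ.- coeff x w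
coeff-neg []            w = refl
coeff-neg ((q , u) ∷ x) w with u ≟w w
... | yes _ = trans (cong (ℚ.- q ℚ.+_) (coeff-neg x w)) (sym (ℚP.neg-distrib-+ q _))
... | no  _ = coeff-neg x w

coeff-∷-≡ : ∀ q u u′ x x′ w w′ → (u ≡ w → u′ ≡ w′) → (u′ ≡ w′ → u ≡ w) →
            coeff x w ≡ coeff x′ w′ → coeff ((q , u) ∷ x) w ≡ coeff ((q , u′) ∷ x′) w′
coeff-∷-≡ q u u′ x x′ w w′ to from eq with u ≟w w | u′ ≟w w′
... | yes _  | yes _  = cong (q ℚ.+_) eq
... | yes p  | no ¬p′ = contradiction (to p) ¬p′
... | no ¬p  | yes p′ = contradiction (from p′) ¬p
... | no _   | no _   = eq

coeff-∷-≢ : ∀ q u x w → u ≢ w → coeff ((q , u) ∷ x) w ≡ coeff x w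
coeff-∷-≢ q u x w u≢w with u ≟w w
... | yes u≡w = contradiction u≡w u≢w
... | no  _   = refl

≋-refl : ∀ {x} → x ≋ x
≋-refl = pointwise λ _ → refl

≋-sym : ∀ {x y} → x ≋ y → y ≋ x
≋-sym (pointwise p) = pointwise λ w → sym (p w)

≋-trans : ∀ {x y z} → x ≋ y → y ≋ z → x ≋ z
≋-trans (pointwise p) (pointwise q) = pointwise λ w → trans (p w) (q w)

≡⇒≋ : ∀ {x y} → x ≡ y → x ≋ y
≡⇒≋ refl = ≋-refl

⊕-cong : ∀ {x x′ y y′} → x ≋ x′ → y ≋ y′ → x ⊕ y ≋ x′ ⊕ y′
⊕-cong {x} {x′} {y} {y′} (pointwise p) (pointwise q) = pointwise λ w → begin
  coeff (x ⊕ y) w              ≡⟨ coeff-⊕ x y w ⟩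
  coeff x w ℚ.+ coeff y w      ≡⟨ cong₂ ℚ._+_ (p w) (q w) ⟩
  coeff x′ w ℚ.+ coeff y′ w    ≡⟨ coeff-⊕ x′ y′ w ⟨
  coeff (x′ ⊕ y′) w            ∎
  where open ≡-Reasoning

⊕-comm : ∀ x y → x ⊕ y ≋ y ⊕ x
⊕-comm x y = pointwise λ w →
  trans (coeff-⊕ x y w) (trans (ℚP.+-comm (coeff x w) _) (sym (coeff-⊕ y x w)))

neg-inverseˡ : ∀ x → neg x ⊕ x ≋ []
neg-inverseˡ x = pointwise λ w →
  trans (coeff-⊕ (neg x) x w)
    (trans (cong (ℚ._+ coeff x w) (coeff-neg x w)) (ℚP.+-inverseˡ (coeff x w)))

neg-cong : ∀ {x y} → x ≋ y → neg x ≋ neg y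
neg-cong {x} {y} (pointwise p) = pointwise λ w →
  trans (coeff-neg x w) (trans (cong ℚ.-_ (p w)) (sym (coeff-neg y w)))

H-abelianGroup : AbelianGroup _ _
H-abelianGroup = record
  { Carrier = H ; _≈_ = _≋_ ; _∙_ = _⊕_ ; ε = [] ; _⁻¹ = neg
  ; isAbelianGroup = record
    { isGroup = record
      { isMonoid = record
        { isSemigroup = record
          { isMagma = record
            { isEquivalence = record { refl = ≋-refl ; sym = ≋-sym ; trans = ≋-trans }
            ; ∙-cong = ⊕-cong }
          ; assoc = λ x y z → ≡⇒≋ (ListP.++-assoc x y z) }
        ; identity = (λ _ → ≋-refl) , (λ x → ≡⇒≋ (ListP.++-identityʳ x)) }
      ; inverse = neg-inverseˡ , (λ x → ≋-trans (⊕-comm x (neg x)) (neg-inverseˡ x))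
      ; ⁻¹-cong = neg-cong }
    ; comm = ⊕-comm } }

open AbelianGroup H-abelianGroup
  using (_-_)
  renaming (setoid to ≋-setoid; assoc to ⊕-assoc; identityʳ to ⊕-identityʳ;
            ∙-congˡ to ⊕-congˡ; ∙-congʳ to ⊕-congʳ)
open AbelianGroupProperties H-abelianGroup
  using (x∙y⁻¹≈ε⇒x≈y; //-rightDividesˡ; ∙-cancelʳ)
open CommutativeSemigroupProperties (AbelianGroup.commutativeSemigroup H-abelianGroup)
  using (x∙yz≈y∙xz; interchange)
module ≋-Reasoning = SetoidReasoning ≋-setoid

·-cong : ∀ c {x y} → x ≋ y → c · x ≋ c · y
·-cong c {x} {y} (pointwise p) = pointwise λ w →
  trans (coeff-· c x w) (trans (cong (c ℚ.*_) (p w)) (sym (coeff-· c y w)))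

·-distribˡ-⊕ : ∀ c x y → c · (x ⊕ y) ≡ c · x ⊕ c · y
·-distribˡ-⊕ c = ListP.map-++ _

·-distribʳ-+ : ∀ a b x → (a ℚ.+ b) · x ≋ a · x ⊕ b · x
·-distribʳ-+ a b x = pointwise λ w → begin
  coeff ((a ℚ.+ b) · x) w                  ≡⟨ coeff-· (a ℚ.+ b) x w ⟩
  (a ℚ.+ b) ℚ.* coeff x w                  ≡⟨ ℚP.*-distribʳ-+ (coeff x w) a b ⟩
  a ℚ.* coeff x w ℚ.+ b ℚ.* coeff x w      ≡⟨ cong₂ ℚ._+_ (coeff-· a x w) (coeff-· b x w) ⟨
  coeff (a · x) w ℚ.+ coeff (b · x) w      ≡⟨ coeff-⊕ (a · x) (b · x) w ⟨
  coeff (a · x ⊕ b · x) w                  ∎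
  where open ≡-Reasoning

·-assoc : ∀ c d x → c · (d · x) ≋ (c ℚ.* d) · x
·-assoc c d x = pointwise λ w → begin
  coeff (c · (d · x)) w       ≡⟨ coeff-· c (d · x) w ⟩
  c ℚ.* coeff (d · x) w       ≡⟨ cong (c ℚ.*_) (coeff-· d x w) ⟩
  c ℚ.* (d ℚ.* coeff x w)     ≡⟨ ℚP.*-assoc c d (coeff x w) ⟨
  c ℚ.* d ℚ.* coeff x w       ≡⟨ coeff-· (c ℚ.* d) x w ⟨
  coeff ((c ℚ.* d) · x) w     ∎
  where open ≡-Reasoning

·-comm : ∀ c d x → c · (d · x) ≋ d · (c · x)
·-comm c d x = ≋-trans (·-assoc c d x)
  (≋-trans (≡⇒≋ (cong (_· x) (ℚP.*-comm c d))) (≋-sym (·-assoc d c x)))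

0·-zero : ∀ x → 0ℚ · x ≋ []
0·-zero x = pointwise λ w → trans (coeff-· 0ℚ x w) (ℚP.*-zeroˡ (coeff x w))

1·-identity : ∀ x → 1ℚ · x ≋ x
1·-identity x = pointwise λ w → trans (coeff-· 1ℚ x w) (ℚP.*-identityˡ (coeff x w))

-·≋neg : ∀ c x → (ℚ.- c) · x ≋ neg (c · x)
-·≋neg c x = pointwise λ w → begin
  coeff ((ℚ.- c) · x) w       ≡⟨ coeff-· (ℚ.- c) x w ⟩
  ℚ.- c ℚ.* coeff x w         ≡⟨ ℚP.neg-distribˡ-* c (coeff x w) ⟨
  ℚ.- (c ℚ.* coeff x w)       ≡⟨ cong ℚ.-_ (coeff-· c x w) ⟨
  ℚ.- coeff (c · x) w         ≡⟨ coeff-neg (c · x) w ⟨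
  coeff (neg (c · x)) w       ∎
  where open ≡-Reasoning

neg-distrib-⊕ : ∀ x y → neg (x ⊕ y) ≡ neg x ⊕ neg y
neg-distrib-⊕ = ListP.map-++ _

∷≋·⟦⟧⊕ : ∀ q u x → (q , u) ∷ x ≋ q · ⟦ u ⟧ ⊕ x
∷≋·⟦⟧⊕ q u x = ⊕-congʳ (≡⇒≋ (cong (λ c → (c , u) ∷ []) (sym (ℚP.*-identityʳ q))))

record IsSubspace (S : H → Set) : Set where
  field
    ≋-closed : ∀ {x y} → x ≋ y → S x → S y
    []-closed : S []
    ⊕-closed : ∀ {x y} → S x → S y → S (x ⊕ y)
    ·-closed : ∀ c {x} → S x → S (c · x)

Supported : (Word → Set) → H → Set
Supported P x = ∀ w → ¬ P w → coeff x w ≡ 0ℚ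

supported-isSubspace : ∀ P → IsSubspace (Supported P)
supported-isSubspace P = record
  { ≋-closed = λ (pointwise p) sx w ¬pw → trans (sym (p w)) (sx w ¬pw)
  ; []-closed = λ _ _ → refl
  ; ⊕-closed = λ {x} {y} sx sy w ¬pw →
      trans (coeff-⊕ x y w) (trans (cong₂ ℚ._+_ (sx w ¬pw) (sy w ¬pw)) (ℚP.+-identityʳ 0ℚ))
  ; ·-closed = λ c {x} sx w ¬pw →
      trans (coeff-· c x w) (trans (cong (c ℚ.*_) (sx w ¬pw)) (ℚP.*-zeroʳ c)) }

remove : Word → H → H
remove u = filter (λ t → ¬? (proj₂ t ≟w u))

coeff-remove-self : ∀ u x → coeff (remove u x) u ≡ 0ℚ
coeff-remove-self u []            = refl
coeff-remove-self u ((q , v) ∷ x) with v ≟w u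
... | yes _   = coeff-remove-self u x
... | no  v≢u = trans (coeff-∷-≢ q v (remove u x) u v≢u) (coeff-remove-self u x)

coeff-remove-other : ∀ u x w → u ≢ w → coeff (remove u x) w ≡ coeff x w
coeff-remove-other u []            w u≢w = refl
coeff-remove-other u ((q , v) ∷ x) w u≢w with v ≟w u
... | yes refl = trans (coeff-remove-other u x w u≢w) (sym (coeff-∷-≢ q v x w u≢w))
... | no  _    = coeff-∷-≡ q v v (remove u x) x w w (λ e → e) (λ e → e) (coeff-remove-other u x w u≢w)

extend : (Word → H) → H → H
extend F []            = []
extend F ((q , u) ∷ x) = q · F u ⊕ extend F x

extend-remove : ∀ F u x → extend F x ≋ coeff x u · F u ⊕ extend F (remove u x)
extend-remove F u [] = ≋-sym (≋-trans (⊕-identityʳ _) (0·-zero (F u)))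
extend-remove F u ((q , v) ∷ x) with v ≟w u
... | yes refl = begin
  q · F v ⊕ extend F x                                     ≈⟨ ⊕-congˡ (extend-remove F v x) ⟩
  q · F v ⊕ (coeff x v · F v ⊕ extend F (remove v x))      ≈⟨ ⊕-assoc (q · F v) (coeff x v · F v) _ ⟨
  (q · F v ⊕ coeff x v · F v) ⊕ extend F (remove v x)      ≈⟨ ⊕-congʳ (·-distribʳ-+ q (coeff x v) (F v)) ⟨
  (q ℚ.+ coeff x v) · F v ⊕ extend F (remove v x)          ∎
  where open ≋-Reasoning
... | no  _ = begin
  q · F v ⊕ extend F x                                     ≈⟨ ⊕-congˡ (extend-remove F u x) ⟩
  q · F v ⊕ (coeff x u · F u ⊕ extend F (remove u x))      ≈⟨ x∙yz≈y∙xz (q · F v) (coeff x u · F u) _ ⟩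
  coeff x u · F u ⊕ (q · F v ⊕ extend F (remove u x))      ∎
  where open ≋-Reasoning

-- Strong induction on the length: splitting off all occurrences of the
-- first word leaves a shorter list with the same support.
extend-closed : ∀ {S P F} → IsSubspace S → Decidable P → (∀ u → P u → S (F u)) →
                ∀ x → Supported P x → S (extend F x)
extend-closed {S} {P} {F} S-sub P? F∈S x sx = go x sx (<-wellFounded (length x))
  where
  open IsSubspace S-sub
  go : ∀ x → Supported P x → Acc ℕ._<_ (length x) → S (extend F x)
  go []                _  _         = []-closed
  go x@((_ , u) ∷ _) sx (acc rec) =
    ≋-closed (≋-sym (extend-remove F u x)) (⊕-closed first (go (remove u x) sx′ (rec shorter)))
    where
    first : S (coeff x u · F u)
    first with P? u
    ... | yes pu = ·-closed (coeff x u) (F∈S u pu)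
    ... | no ¬pu rewrite sx u ¬pu = ≋-closed (≋-sym (0·-zero (F u))) []-closed
    sx′ : Supported P (remove u x)
    sx′ w ¬pw with u ≟w w
    ... | yes refl = coeff-remove-self u x
    ... | no  u≢w  = trans (coeff-remove-other u x w u≢w) (sx w ¬pw)
    shorter : length (remove u x) ℕ.< length x
    shorter = ListP.filter-notAll (λ t → ¬? (proj₂ t ≟w u)) x (here (λ u≢u → u≢u refl))

extend-⊕ : ∀ F x y → extend F (x ⊕ y) ≋ extend F x ⊕ extend F y
extend-⊕ F []            y = ≋-refl
extend-⊕ F ((q , u) ∷ x) y =
  ≋-trans (⊕-congˡ (extend-⊕ F x y)) (≋-sym (⊕-assoc (q · F u) (extend F x) (extend F y)))

extend-· : ∀ F c x → extend F (c · x) ≋ c · extend F x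
extend-· F c []            = ≋-refl
extend-· F c ((q , u) ∷ x) = ≋-trans (⊕-cong (≋-sym (·-assoc c q (F u))) (extend-· F c x))
  (≡⇒≋ (sym (·-distribˡ-⊕ c (q · F u) (extend F x))))

extend-neg : ∀ F x → extend F (neg x) ≋ neg (extend F x)
extend-neg F []            = ≋-refl
extend-neg F ((q , u) ∷ x) = ≋-trans (⊕-cong (-·≋neg q (F u)) (extend-neg F x))
  (≡⇒≋ (sym (neg-distrib-⊕ (q · F u) (extend F x))))

extend-cong : ∀ F {x y} → x ≋ y → extend F x ≋ extend F y
extend-cong F {x} {y} (pointwise p) = x∙y⁻¹≈ε⇒x≈y (extend F x) (extend F y) (begin
  extend F x - extend F y             ≈⟨ ⊕-congˡ (extend-neg F y) ⟨
  extend F x ⊕ extend F (neg y)       ≈⟨ extend-⊕ F x (neg y) ⟨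
  extend F (x - y)                    ≈⟨ extend-closed isZero (λ _ → no λ ()) (λ _ ()) (x - y) x-y≈0 ⟩
  []                                  ∎)
  where
  open ≋-Reasoning
  isZero : IsSubspace (_≋ [])
  isZero = record
    { ≋-closed = λ x≋y x≋0 → ≋-trans (≋-sym x≋y) x≋0
    ; []-closed = ≋-refl
    ; ⊕-closed = λ x≋0 y≋0 → ⊕-cong x≋0 y≋0
    ; ·-closed = λ c x≋0 → ·-cong c x≋0 }
  x-y≈0 : Supported (λ _ → ⊥) (x - y)
  x-y≈0 w _ = trans (coeff-⊕ x (neg y) w)
    (trans (cong₂ ℚ._+_ (p w) (coeff-neg y w)) (ℚP.+-inverseʳ (coeff y w)))

extend-congᶠ : ∀ {F G} → (∀ u → F u ≋ G u) → ∀ x → extend F x ≋ extend G x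
extend-congᶠ F≋G []            = ≋-refl
extend-congᶠ F≋G ((q , u) ∷ x) = ⊕-cong (·-cong q (F≋G u)) (extend-congᶠ F≋G x)

extend-⟦⟧ : ∀ F u → extend F ⟦ u ⟧ ≋ F u
extend-⟦⟧ F u = ≋-trans (⊕-identityʳ (1ℚ · F u)) (1·-identity (F u))

record IsLinear (f : H → H) : Set where
  field
    ≋-cong : ∀ {x y} → x ≋ y → f x ≋ f y
    ⊕-homo : ∀ x y → f (x ⊕ y) ≋ f x ⊕ f y
    ·-homo : ∀ c x → f (c · x) ≋ c · f x
open IsLinear

extend-isLinear : ∀ F → IsLinear (extend F)
extend-isLinear F = record { ≋-cong = extend-cong F ; ⊕-homo = extend-⊕ F ; ·-homo = extend-· F }

extend-⊕ᶠ : ∀ F G x → extend (λ u → F u ⊕ G u) x ≋ extend F x ⊕ extend G x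
extend-⊕ᶠ F G []            = ≋-refl
extend-⊕ᶠ F G ((q , u) ∷ x) = ≋-trans (⊕-cong (≡⇒≋ (·-distribˡ-⊕ q (F u) (G u))) (extend-⊕ᶠ F G x))
  (interchange (q · F u) (q · G u) (extend F x) (extend G x))

extend-·ᶠ : ∀ F c x → extend (λ u → c · F u) x ≋ c · extend F x
extend-·ᶠ F c []            = ≋-refl
extend-·ᶠ F c ((q , u) ∷ x) = ≋-trans (⊕-cong (·-comm q c (F u)) (extend-·ᶠ F c x))
  (≡⇒≋ (sym (·-distribˡ-⊕ c (q · F u) (extend F x))))

extend-isLinearᶠ : ∀ {G : Word → H → H} → (∀ u → IsLinear (G u)) →
                   ∀ x → IsLinear (λ y → extend (λ u → G u y) x)
extend-isLinearᶠ {G} G-lin x = record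
  { ≋-cong = λ y≋y′ → extend-congᶠ (λ u → ≋-cong (G-lin u) y≋y′) x
  ; ⊕-homo = λ y y′ → ≋-trans (extend-congᶠ (λ u → ⊕-homo (G-lin u) y y′) x)
                                (extend-⊕ᶠ (λ u → G u y) (λ u → G u y′) x)
  ; ·-homo = λ c y → ≋-trans (extend-congᶠ (λ u → ·-homo (G-lin u) c y) x)
                               (extend-·ᶠ (λ u → G u y) c x) }

linear-[] : ∀ {f} → IsLinear f → f [] ≋ []
linear-[] {f} f-lin = ≋-trans (·-homo f-lin 0ℚ []) (0·-zero (f []))

linear≋extend : ∀ {f} → IsLinear f → ∀ x → f x ≋ extend (λ u → f ⟦ u ⟧) x
linear≋extend f-lin []            = linear-[] f-lin
linear≋extend {f} f-lin ((q , u) ∷ x) = begin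
  f ((q , u) ∷ x)                          ≈⟨ ≋-cong f-lin (∷≋·⟦⟧⊕ q u x) ⟩
  f (q · ⟦ u ⟧ ⊕ x)                        ≈⟨ ⊕-homo f-lin (q · ⟦ u ⟧) x ⟩
  f (q · ⟦ u ⟧) ⊕ f x                      ≈⟨ ⊕-cong (·-homo f-lin q ⟦ u ⟧) (linear≋extend f-lin x) ⟩
  q · f ⟦ u ⟧ ⊕ extend (λ u → f ⟦ u ⟧) x   ∎
  where open ≋-Reasoning

linear-unique : ∀ {f g} → IsLinear f → IsLinear g → (∀ u → f ⟦ u ⟧ ≋ g ⟦ u ⟧) → ∀ x → f x ≋ g x
linear-unique f-lin g-lin f≋g x = ≋-trans (linear≋extend f-lin x)
  (≋-trans (extend-congᶠ f≋g x) (≋-sym (linear≋extend g-lin x)))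

extend-⟦⟧-identity : ∀ x → extend ⟦_⟧ x ≋ x
extend-⟦⟧-identity []            = ≋-refl
extend-⟦⟧-identity ((q , u) ∷ x) = ≋-trans (⊕-congˡ (extend-⟦⟧-identity x)) (≋-sym (∷≋·⟦⟧⊕ q u x))

span-closed : ∀ {S P} → IsSubspace S → Decidable P → (∀ u → P u → S ⟦ u ⟧) →
              ∀ x → Supported P x → S x
span-closed S-sub P? ⟦⟧∈S x sx =
  IsSubspace.≋-closed S-sub (extend-⟦⟧-identity x) (extend-closed S-sub P? ⟦⟧∈S x sx)

preimage-isSubspace : ∀ {f S} → IsLinear f → IsSubspace S → IsSubspace (λ x → S (f x))
preimage-isSubspace {f} f-lin S-sub = record
  { ≋-closed = λ x≋y → ≋-closed (≋-cong f-lin x≋y)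
  ; []-closed = ≋-closed (≋-sym (linear-[] f-lin)) []-closed
  ; ⊕-closed = λ {x} {y} sx sy → ≋-closed (≋-sym (⊕-homo f-lin x y)) (⊕-closed sx sy)
  ; ·-closed = λ c {x} sx → ≋-closed (≋-sym (·-homo f-lin c x)) (·-closed c sx) }
  where open IsSubspace S-sub

equalizer-isSubspace : ∀ {f g} → IsLinear f → IsLinear g → IsSubspace (λ x → f x ≋ g x)
equalizer-isSubspace {f} {g} f-lin g-lin = record
  { ≋-closed = λ x≋y fx≋gx → ≋-trans (≋-sym (≋-cong f-lin x≋y)) (≋-trans fx≋gx (≋-cong g-lin x≋y))
  ; []-closed = ≋-trans (linear-[] f-lin) (≋-sym (linear-[] g-lin))
  ; ⊕-closed = λ {x} {y} fx≋gx fy≋gy →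
      ≋-trans (⊕-homo f-lin x y) (≋-trans (⊕-cong fx≋gx fy≋gy) (≋-sym (⊕-homo g-lin x y)))
  ; ·-closed = λ c {x} fx≋gx →
      ≋-trans (·-homo f-lin c x) (≋-trans (·-cong c fx≋gx) (≋-sym (·-homo g-lin c x))) }

≗-isLinear : ∀ {f g} → (∀ x → f x ≡ g x) → IsLinear g → IsLinear f
≗-isLinear {f} {g} f≗g g-lin = record
  { ≋-cong = λ {x} {y} x≋y → ≋-trans (≡⇒≋ (f≗g x)) (≋-trans (≋-cong g-lin x≋y) (≡⇒≋ (sym (f≗g y))))
  ; ⊕-homo = λ x y → ≋-trans (≡⇒≋ (f≗g (x ⊕ y)))
      (≋-trans (⊕-homo g-lin x y) (≡⇒≋ (sym (cong₂ _⊕_ (f≗g x) (f≗g y)))))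
  ; ·-homo = λ c x → ≋-trans (≡⇒≋ (f≗g (c · x)))
      (≋-trans (·-homo g-lin c x) (≡⇒≋ (sym (cong (c ·_) (f≗g x))))) }

∘-isLinear : ∀ {f g} → IsLinear f → IsLinear g → IsLinear (λ x → f (g x))
∘-isLinear {f} {g} f-lin g-lin = record
  { ≋-cong = λ x≋y → ≋-cong f-lin (≋-cong g-lin x≋y)
  ; ⊕-homo = λ x y → ≋-trans (≋-cong f-lin (⊕-homo g-lin x y)) (⊕-homo f-lin (g x) (g y))
  ; ·-homo = λ c x → ≋-trans (≋-cong f-lin (·-homo g-lin c x)) (·-homo f-lin c (g x)) }

⊕-isLinear : ∀ {f g} → IsLinear f → IsLinear g → IsLinear (λ x → f x ⊕ g x)
⊕-isLinear {f} {g} f-lin g-lin = record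
  { ≋-cong = λ x≋y → ⊕-cong (≋-cong f-lin x≋y) (≋-cong g-lin x≋y)
  ; ⊕-homo = λ x y → ≋-trans (⊕-cong (⊕-homo f-lin x y) (⊕-homo g-lin x y))
                              (interchange (f x) (f y) (g x) (g y))
  ; ·-homo = λ c x → ≋-trans (⊕-cong (·-homo f-lin c x) (·-homo g-lin c x))
                              (≡⇒≋ (sym (·-distribˡ-⊕ c (f x) (g x)))) }

-- Operators on the first letter

module ℤGroup = GroupProperties (AbelianGroup.group ℤP.+-0-abelianGroup)

inc dec : ℤ → ℤ
inc s = s ℤ.+ 1ℤ
dec s = s ℤ.- 1ℤ

inc-dec : ∀ s → inc (dec s) ≡ s
inc-dec s = ℤGroup.//-rightDividesˡ 1ℤ s

dec-inc : ∀ s → dec (inc s) ≡ s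
dec-inc s = ℤGroup.//-rightDividesʳ 1ℤ s

mapHead : (ℤ → ℤ) → H → H
mapHead f []                   = []
mapHead f ((q , [])     ∷ x)   = mapHead f x
mapHead f ((q , s ∷ ss) ∷ x)   = (q , f s ∷ ss) ∷ mapHead f x

J≡mapHead-dec : ∀ x → J x ≡ mapHead dec x
J≡mapHead-dec []                 = refl
J≡mapHead-dec ((q , [])     ∷ x) = J≡mapHead-dec x
J≡mapHead-dec ((q , s ∷ ss) ∷ x) = cong (_ ∷_) (J≡mapHead-dec x)

raise : H → H
raise = mapHead inc

NoUnit : H → Set
NoUnit x = coeff x [] ≡ 0ℚ

mapHead-noUnit : ∀ f x → NoUnit (mapHead f x)
mapHead-noUnit f []                 = refl
mapHead-noUnit f ((q , [])     ∷ x) = mapHead-noUnit f x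
mapHead-noUnit f ((q , s ∷ ss) ∷ x) =
  trans (coeff-∷-≢ q (f s ∷ ss) (mapHead f x) [] λ ()) (mapHead-noUnit f x)

coeff-mapHead : ∀ (f g : ℤ → ℤ) → (∀ s → f (g s) ≡ s) → (∀ s → g (f s) ≡ s) →
                ∀ x s ss → coeff (mapHead f x) (s ∷ ss) ≡ coeff x (g s ∷ ss)
coeff-mapHead f g fg gf []                 s ss = refl
coeff-mapHead f g fg gf ((q , [])     ∷ x) s ss =
  trans (coeff-mapHead f g fg gf x s ss) (sym (coeff-∷-≢ q [] x (g s ∷ ss) λ ()))
coeff-mapHead f g fg gf ((q , t ∷ ts) ∷ x) s ss =
  coeff-∷-≡ q (f t ∷ ts) (t ∷ ts) (mapHead f x) x (s ∷ ss) (g s ∷ ss) to from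
    (coeff-mapHead f g fg gf x s ss)
  where
  to : f t ∷ ts ≡ s ∷ ss → t ∷ ts ≡ g s ∷ ss
  to refl = cong (_∷ ts) (sym (gf t))
  from : t ∷ ts ≡ g s ∷ ss → f t ∷ ts ≡ s ∷ ss
  from refl = cong (_∷ ss) (fg s)

coeff-J : ∀ x s ss → coeff (J x) (s ∷ ss) ≡ coeff x (inc s ∷ ss)
coeff-J x s ss rewrite J≡mapHead-dec x = coeff-mapHead dec inc dec-inc inc-dec x s ss

coeff-raise : ∀ x s ss → coeff (raise x) (s ∷ ss) ≡ coeff x (dec s ∷ ss)
coeff-raise = coeff-mapHead inc dec inc-dec dec-inc

J-noUnit : ∀ x → NoUnit (J x)
J-noUnit x rewrite J≡mapHead-dec x = mapHead-noUnit dec x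

J-raise : ∀ x → NoUnit x → J (raise x) ≋ x
J-raise x x₀ = pointwise λ where
  []       → trans (J-noUnit (raise x)) (sym x₀)
  (s ∷ ss) → trans (coeff-J (raise x) s ss)
               (trans (coeff-raise x (inc s) ss) (cong (λ t → coeff x (t ∷ ss)) (dec-inc s)))

J-injective : ∀ {x y} → NoUnit x → NoUnit y → J x ≋ J y → x ≋ y
J-injective {x} {y} x₀ y₀ (pointwise p) = pointwise x≈y
  where
  open ≡-Reasoning
  x≈y : x ≈ y
  x≈y []       = trans x₀ (sym y₀)
  x≈y (s ∷ ss) = begin
    coeff x (s ∷ ss)             ≡⟨ cong (λ t → coeff x (t ∷ ss)) (inc-dec s) ⟨
    coeff x (inc (dec s) ∷ ss)   ≡⟨ coeff-J x (dec s) ss ⟨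
    coeff (J x) (dec s ∷ ss)     ≡⟨ p (dec s ∷ ss) ⟩
    coeff (J y) (dec s ∷ ss)     ≡⟨ coeff-J y (dec s) ss ⟩
    coeff y (inc (dec s) ∷ ss)   ≡⟨ cong (λ t → coeff y (t ∷ ss)) (inc-dec s) ⟩
    coeff y (s ∷ ss)             ∎

mapHead-⊕ : ∀ f x y → mapHead f (x ⊕ y) ≡ mapHead f x ⊕ mapHead f y
mapHead-⊕ f []                 y = refl
mapHead-⊕ f ((q , [])     ∷ x) y = mapHead-⊕ f x y
mapHead-⊕ f ((q , s ∷ ss) ∷ x) y = cong (_ ∷_) (mapHead-⊕ f x y)

mapHead-· : ∀ f c x → mapHead f (c · x) ≡ c · mapHead f x
mapHead-· f c []                 = refl
mapHead-· f c ((q , [])     ∷ x) = mapHead-· f c x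
mapHead-· f c ((q , s ∷ ss) ∷ x) = cong (_ ∷_) (mapHead-· f c x)

mapHead-isLinear : ∀ f g → (∀ s → f (g s) ≡ s) → (∀ s → g (f s) ≡ s) → IsLinear (mapHead f)
mapHead-isLinear f g fg gf = record
  { ≋-cong = λ {x} {y} (pointwise p) → pointwise λ where
      []       → trans (mapHead-noUnit f x) (sym (mapHead-noUnit f y))
      (s ∷ ss) → trans (coeff-mapHead f g fg gf x s ss)
                   (trans (p (g s ∷ ss)) (sym (coeff-mapHead f g fg gf y s ss)))
  ; ⊕-homo = λ x y → ≡⇒≋ (mapHead-⊕ f x y)
  ; ·-homo = λ c x → ≡⇒≋ (mapHead-· f c x) }

J-isLinear : IsLinear J
J-isLinear = ≗-isLinear J≡mapHead-dec (mapHead-isLinear dec inc dec-inc inc-dec)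

prefix : ℤ → H → H
prefix s = map (map₂ (s ∷_))

coeff-prefix-[] : ∀ s x → coeff (prefix s x) [] ≡ 0ℚ
coeff-prefix-[] s []            = refl
coeff-prefix-[] s ((q , u) ∷ x) =
  trans (coeff-∷-≢ q (s ∷ u) (prefix s x) [] λ ()) (coeff-prefix-[] s x)

coeff-prefix : ∀ s x w → coeff (prefix s x) (s ∷ w) ≡ coeff x w
coeff-prefix s []            w = refl
coeff-prefix s ((q , u) ∷ x) w =
  coeff-∷-≡ q (s ∷ u) u (prefix s x) x (s ∷ w) w ∷-injectiveʳ (cong (s ∷_)) (coeff-prefix s x w)

coeff-prefix-≢ : ∀ s x t w → t ≢ s → coeff (prefix s x) (t ∷ w) ≡ 0ℚ
coeff-prefix-≢ s []            t w t≢s = refl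
coeff-prefix-≢ s ((q , u) ∷ x) t w t≢s =
  trans (coeff-∷-≢ q (s ∷ u) (prefix s x) (t ∷ w) (λ e → t≢s (sym (∷-injectiveˡ e))))
        (coeff-prefix-≢ s x t w t≢s)

prefix-· : ∀ s c x → prefix s (c · x) ≡ c · prefix s x
prefix-· s c []            = refl
prefix-· s c ((q , u) ∷ x) = cong (_ ∷_) (prefix-· s c x)

prefix-isLinear : ∀ s → IsLinear (prefix s)
prefix-isLinear s = record
  { ≋-cong = λ {x} {y} (pointwise p) → pointwise λ where
      []      → trans (coeff-prefix-[] s x) (sym (coeff-prefix-[] s y))
      (t ∷ w) → case t ℤ.≟ s of λ where
        (yes refl) → trans (coeff-prefix s x w) (trans (p w) (sym (coeff-prefix s y w)))
        (no t≢s)   → trans (coeff-prefix-≢ s x t w t≢s) (sym (coeff-prefix-≢ s y t w t≢s))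
  ; ⊕-homo = λ x y → ≡⇒≋ (ListP.map-++ _ x y)
  ; ·-homo = λ c x → ≡⇒≋ (prefix-· s c x) }

supported-mono : ∀ {P Q} → (∀ w → P w → Q w) → ∀ x → Supported P x → Supported Q x
supported-mono P⇒Q x sx w ¬qw = sx w (λ pw → ¬qw (P⇒Q w pw))

supported-prefix : ∀ {P Q} s → (∀ w → P w → Q (s ∷ w)) →
                   ∀ x → Supported P x → Supported Q (prefix s x)
supported-prefix s P⇒Q x sx []      _   = coeff-prefix-[] s x
supported-prefix s P⇒Q x sx (t ∷ w) ¬qw with t ℤ.≟ s
... | yes refl = trans (coeff-prefix s x w) (sx w (λ pw → ¬qw (P⇒Q w pw)))
... | no  t≢s  = coeff-prefix-≢ s x t w t≢s

supported-mapHead : ∀ {P Q} f g → (∀ s → f (g s) ≡ s) → (∀ s → g (f s) ≡ s) →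
                    (∀ s ss → P (g s ∷ ss) → Q (s ∷ ss)) →
                    ∀ x → Supported P x → Supported Q (mapHead f x)
supported-mapHead f g fg gf P⇒Q x sx []       _   = mapHead-noUnit f x
supported-mapHead f g fg gf P⇒Q x sx (s ∷ ss) ¬qw =
  trans (coeff-mapHead f g fg gf x s ss) (sx (g s ∷ ss) (λ pw → ¬qw (P⇒Q s ss pw)))

-- Solving the Leibniz rule on the plane of first letters

NonNegativeHead PositiveHead : Word → Set
NonNegativeHead (+ _ ∷ _) = ⊤
NonNegativeHead _         = ⊥
PositiveHead (+[1+ _ ] ∷ _) = ⊤
PositiveHead _              = ⊥

positiveHead? : Decidable PositiveHead
positiveHead? []              = no λ ()
positiveHead? (+ zero   ∷ _)  = no λ ()
positiveHead? (+[1+ _ ] ∷ _)  = yes tt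
positiveHead? (-[1+ _ ] ∷ _)  = no λ ()

positive⇒nonNegative : ∀ w → PositiveHead w → NonNegativeHead w
positive⇒nonNegative (+[1+ _ ] ∷ _) _ = tt

raise-positive : ∀ x → Supported NonNegativeHead x → Supported PositiveHead (raise x)
raise-positive = supported-mapHead inc dec inc-dec dec-inc nonNegative-dec
  where
  nonNegative-dec : ∀ s ss → NonNegativeHead (dec s ∷ ss) → PositiveHead (s ∷ ss)
  nonNegative-dec +[1+ _ ] _ _ = tt

-- The Leibniz rule  J (grid a b) ≋ grid (dec a) b ⊕ grid a (dec b)  read as a
-- definition: for a, b > 0 solve for grid a b (raise inverts J on vectors
-- without unit component); when a coordinate is not positive, solve for the
-- value with that coordinate lowered.
module Grid (atZero : ℤ → H) (onAxis : ℕ → H) where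
  mutual
    fromNat : ℕ → ℤ → H
    fromNat zero    b        = atZero b
    fromNat (suc m) (+ n)    = upper m n
    fromNat (suc m) -[1+ n ] = lower m n

    upper : ℕ → ℕ → H
    upper m zero    = onAxis m
    upper m (suc n) = raise (fromNat m +[1+ n ] ⊕ upper m n)

    lower : ℕ → ℕ → H
    lower m zero    = J (onAxis m) - fromNat m (+ 0)
    lower m (suc n) = J (lower m n) - fromNat m -[1+ n ]

  fromNeg : ℕ → ℤ → H
  fromNeg zero    b = J (atZero b) - atZero (dec b)
  fromNeg (suc m) b = J (fromNeg m b) - fromNeg m (dec b)

  grid : ℤ → ℤ → H
  grid (+ m)    = fromNat m
  grid -[1+ m ] = fromNeg m

  module _ (atZero-noUnit : ∀ b → NoUnit (atZero b)) (onAxis-noUnit : ∀ m → NoUnit (onAxis m)) where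
    fromNat-noUnit : ∀ m n → NoUnit (fromNat m (+ n))
    fromNat-noUnit zero    n       = atZero-noUnit (+ n)
    fromNat-noUnit (suc m) zero    = onAxis-noUnit m
    fromNat-noUnit (suc m) (suc n) = mapHead-noUnit inc (fromNat m +[1+ n ] ⊕ upper m n)

    grid-leibniz : ∀ a b → J (grid a b) ≋ grid (dec a) b ⊕ grid a (dec b)
    grid-leibniz (+ zero) b = ≋-sym (//-rightDividesˡ (atZero (dec b)) (J (atZero b)))
    -- dec -[1+ m ] normalises to -[1+ suc (m ℕ.+ 0) ].
    grid-leibniz -[1+ m ] b rewrite ℕP.+-identityʳ m =
      ≋-sym (//-rightDividesˡ (fromNeg m (dec b)) (J (fromNeg m b)))
    grid-leibniz +[1+ m ] (+ zero) = ≋-sym (≋-trans (⊕-comm (fromNat m (+ 0)) (lower m 0))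
      (//-rightDividesˡ (fromNat m (+ 0)) (J (onAxis m))))
    grid-leibniz +[1+ m ] +[1+ n ] = J-raise (fromNat m +[1+ n ] ⊕ upper m n)
      (trans (coeff-⊕ (fromNat m +[1+ n ]) (upper m n) [])
        (trans (cong₂ ℚ._+_ (fromNat-noUnit m (suc n)) (fromNat-noUnit (suc m) n)) (ℚP.+-identityʳ 0ℚ)))
    grid-leibniz +[1+ m ] -[1+ n ] rewrite ℕP.+-identityʳ n =
      ≋-sym (≋-trans (⊕-comm (fromNat m -[1+ n ]) (lower m (suc n)))
      (//-rightDividesˡ (fromNat m -[1+ n ]) (J (lower m n))))

  grid-closed : ∀ {S} → IsSubspace S → (∀ x → S x → S (J x)) → (∀ x → S x → S (raise x)) →
                (∀ b → S (atZero b)) → (∀ m → S (onAxis m)) → ∀ a b → S (grid a b)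
  grid-closed {S} S-sub S-J S-raise S-atZero S-onAxis = λ where
      (+ m)    b → nat m b
      -[1+ m ] b → negative m b
    where
    open IsSubspace S-sub
    S-J- : ∀ {x y} → S x → S y → S (J x - y)
    S-J- {x} {y} sx sy = ⊕-closed (S-J x sx)
      (≋-closed (≋-trans (-·≋neg 1ℚ y) (neg-cong (1·-identity y))) (·-closed (ℚ.- 1ℚ) sy))
    mutual
      nat : ∀ m b → S (fromNat m b)
      nat zero    b        = S-atZero b
      nat (suc m) (+ n)    = up m n
      nat (suc m) -[1+ n ] = low m n
      up : ∀ m n → S (upper m n)
      up m zero    = S-onAxis m
      up m (suc n) = S-raise _ (⊕-closed (nat m +[1+ n ]) (up m n))
      low : ∀ m n → S (lower m n)
      low m zero    = S-J- (S-onAxis m) (nat m (+ 0))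
      low m (suc n) = S-J- (low m n) (nat m -[1+ n ])
    negative : ∀ m b → S (fromNeg m b)
    negative zero    b = S-J- (S-atZero b) (S-atZero (dec b))
    negative (suc m) b = S-J- (negative m b) (negative m (dec b))

  grid-positive : (∀ b → Supported NonNegativeHead (atZero b)) →
                  (∀ m → Supported NonNegativeHead (onAxis m)) →
                  ∀ m n → Supported PositiveHead (grid +[1+ m ] +[1+ n ])
  grid-positive atZero-nonNeg onAxis-nonNeg = positive
    where
    mutual
      nonNeg : ∀ m n → Supported NonNegativeHead (fromNat m (+ n))
      nonNeg zero    n       = atZero-nonNeg (+ n)
      nonNeg (suc m) zero    = onAxis-nonNeg m
      nonNeg (suc m) (suc n) = supported-mono positive⇒nonNegative (upper m (suc n)) (positive m n)
      positive : ∀ m n → Supported PositiveHead (upper m (suc n))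
      positive m n = raise-positive (fromNat m +[1+ n ] ⊕ upper m n)
        (IsSubspace.⊕-closed (supported-isSubspace _) {fromNat m +[1+ n ]} {upper m n}
          (nonNeg m (suc n)) (nonNeg (suc m) n))

-- On nonempty words the product is the grid solution whose boundary values
-- are forced by the zero rules and associativity:
-- [0, u] ⧢ y = [0] ⧢ ([u] ⧢ y) and, for a > 0, [a, u] ⧢ [0, v] = [0, a, u] ⧢ [v].
mutual
  infixl 7 _⧢ʷ_
  _⧢ʷ_ : Word → Word → H
  []      ⧢ʷ v = ⟦ v ⟧
  (a ∷ u) ⧢ʷ v = consProduct a u v

  consProduct : ℤ → Word → Word → H
  consProduct a u []      = ⟦ a ∷ u ⟧
  consProduct a u (b ∷ v) = Grid.grid (firstZero u v) (secondZero u v) a b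

  firstZero : Word → Word → ℤ → H
  firstZero u v b = prefix 0ℤ (u ⧢ʷ (b ∷ v))

  secondZero : Word → Word → ℕ → H
  secondZero u v m = prefix 0ℤ (consProduct +[1+ m ] u v)

infixl 7 _⧢_
_⧢_ : H → H → H
x ⧢ y = extend (λ u → extend (u ⧢ʷ_) y) x

⧢-isLinearˡ : ∀ y → IsLinear (_⧢ y)
⧢-isLinearˡ y = extend-isLinear (λ u → extend (u ⧢ʷ_) y)

⧢-isLinearʳ : ∀ x → IsLinear (x ⧢_)
⧢-isLinearʳ = extend-isLinearᶠ (λ u → extend-isLinear (u ⧢ʷ_))

⧢-congˡ : ∀ z {x y} → x ≋ y → x ⧢ z ≋ y ⧢ z
⧢-congˡ z = ≋-cong (⧢-isLinearˡ z)

⧢-congʳ : ∀ x {y z} → y ≋ z → x ⧢ y ≋ x ⧢ z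
⧢-congʳ x = ≋-cong (⧢-isLinearʳ x)

⟦⟧⧢ : ∀ u y → ⟦ u ⟧ ⧢ y ≋ extend (u ⧢ʷ_) y
⟦⟧⧢ u y = extend-⟦⟧ (λ u → extend (u ⧢ʷ_) y) u

⟦⟧⧢⟦⟧ : ∀ u v → ⟦ u ⟧ ⧢ ⟦ v ⟧ ≋ u ⧢ʷ v
⟦⟧⧢⟦⟧ u v = ≋-trans (⟦⟧⧢ u ⟦ v ⟧) (extend-⟦⟧ (u ⧢ʷ_) v)

⧢ʷ-[] : ∀ u → u ⧢ʷ [] ≡ ⟦ u ⟧
⧢ʷ-[] []      = refl
⧢ʷ-[] (a ∷ u) = refl

⧢-identityˡ : ∀ x → 𝟏 ⧢ x ≋ x
⧢-identityˡ x = ≋-trans (⟦⟧⧢ [] x) (extend-⟦⟧-identity x)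

⧢-identityʳ : ∀ x → x ⧢ 𝟏 ≋ x
⧢-identityʳ x = ≋-trans
  (extend-congᶠ (λ u → ≋-trans (extend-⟦⟧ (u ⧢ʷ_) []) (≡⇒≋ (⧢ʷ-[] u))) x) (extend-⟦⟧-identity x)

⧢-leibniz-⟦⟧ : ∀ u v → J (⟦ u ⟧ ⧢ ⟦ v ⟧) ≋ J ⟦ u ⟧ ⧢ ⟦ v ⟧ ⊕ ⟦ u ⟧ ⧢ J ⟦ v ⟧
⧢-leibniz-⟦⟧ []      v       =
  ≋-trans (≋-cong J-isLinear (⧢-identityˡ ⟦ v ⟧)) (≋-sym (⧢-identityˡ (J ⟦ v ⟧)))
⧢-leibniz-⟦⟧ (a ∷ u) []      = ≋-trans (≋-cong J-isLinear (⧢-identityʳ ⟦ a ∷ u ⟧))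
  (≋-sym (≋-trans (⊕-identityʳ _) (⧢-identityʳ ⟦ dec a ∷ u ⟧)))
⧢-leibniz-⟦⟧ (a ∷ u) (b ∷ v) = begin
  J (⟦ a ∷ u ⟧ ⧢ ⟦ b ∷ v ⟧)                         ≈⟨ ≋-cong J-isLinear (⟦⟧⧢⟦⟧ (a ∷ u) (b ∷ v)) ⟩
  J ((a ∷ u) ⧢ʷ (b ∷ v))
    ≈⟨ grid-leibniz (λ b′ → coeff-prefix-[] 0ℤ (u ⧢ʷ (b′ ∷ v)))
                    (λ m → coeff-prefix-[] 0ℤ (consProduct +[1+ m ] u v)) a b ⟩
  (dec a ∷ u) ⧢ʷ (b ∷ v) ⊕ (a ∷ u) ⧢ʷ (dec b ∷ v)   ≈⟨ ⊕-cong (⟦⟧⧢⟦⟧ (dec a ∷ u) (b ∷ v))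
                                                              (⟦⟧⧢⟦⟧ (a ∷ u) (dec b ∷ v)) ⟨
  ⟦ dec a ∷ u ⟧ ⧢ ⟦ b ∷ v ⟧ ⊕ ⟦ a ∷ u ⟧ ⧢ ⟦ dec b ∷ v ⟧ ∎
  where
  open ≋-Reasoning
  open Grid (firstZero u v) (secondZero u v)

⧢-leibniz : ∀ x y → J (x ⧢ y) ≋ J x ⧢ y ⊕ x ⧢ J y
⧢-leibniz x y = linear-unique
  (∘-isLinear J-isLinear (⧢-isLinearˡ y))
  (⊕-isLinear (∘-isLinear (⧢-isLinearˡ y) J-isLinear) (⧢-isLinearˡ (J y)))
  (λ u → linear-unique
     (∘-isLinear J-isLinear (⧢-isLinearʳ ⟦ u ⟧))
     (⊕-isLinear (⧢-isLinearʳ (J ⟦ u ⟧)) (∘-isLinear (⧢-isLinearʳ ⟦ u ⟧) J-isLinear))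
     (⧢-leibniz-⟦⟧ u) y)
  x

0∷⧢ʷ : ∀ u v → (0ℤ ∷ u) ⧢ʷ v ≡ prefix 0ℤ (u ⧢ʷ v)
0∷⧢ʷ u []      = cong (prefix 0ℤ) (sym (⧢ʷ-[] u))
0∷⧢ʷ u (b ∷ v) = refl

prefix-⧢ : ∀ x y → prefix 0ℤ x ⧢ y ≋ prefix 0ℤ (x ⧢ y)
prefix-⧢ x y = linear-unique
  (∘-isLinear (⧢-isLinearˡ y) (prefix-isLinear 0ℤ))
  (∘-isLinear (prefix-isLinear 0ℤ) (⧢-isLinearˡ y))
  (λ u → linear-unique
     (⧢-isLinearʳ ⟦ 0ℤ ∷ u ⟧)
     (∘-isLinear (prefix-isLinear 0ℤ) (⧢-isLinearʳ ⟦ u ⟧))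
     (λ v → ≋-trans (⟦⟧⧢⟦⟧ (0ℤ ∷ u) v)
              (≋-trans (≡⇒≋ (0∷⧢ʷ u v)) (≋-cong (prefix-isLinear 0ℤ) (≋-sym (⟦⟧⧢⟦⟧ u v)))))
     y)
  x

⧢-prefix : ∀ x y → Supported PositiveHead x → x ⧢ prefix 0ℤ y ≋ prefix 0ℤ (x ⧢ y)
⧢-prefix x y = span-closed
  (equalizer-isSubspace (⧢-isLinearˡ (prefix 0ℤ y)) (∘-isLinear (prefix-isLinear 0ℤ) (⧢-isLinearˡ y)))
  positiveHead? positive x
  where
  positive : ∀ u → PositiveHead u → ⟦ u ⟧ ⧢ prefix 0ℤ y ≋ prefix 0ℤ (⟦ u ⟧ ⧢ y)
  positive (+[1+ m ] ∷ u) _ = linear-unique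
    (∘-isLinear (⧢-isLinearʳ ⟦ +[1+ m ] ∷ u ⟧) (prefix-isLinear 0ℤ))
    (∘-isLinear (prefix-isLinear 0ℤ) (⧢-isLinearʳ ⟦ +[1+ m ] ∷ u ⟧))
    (λ v → ≋-trans (⟦⟧⧢⟦⟧ (+[1+ m ] ∷ u) (0ℤ ∷ v))
             (≋-cong (prefix-isLinear 0ℤ) (≋-sym (⟦⟧⧢⟦⟧ (+[1+ m ] ∷ u) v))))
    y

⧢-positive : ∀ m u n v → Supported PositiveHead (⟦ +[1+ m ] ∷ u ⟧ ⧢ ⟦ +[1+ n ] ∷ v ⟧)
⧢-positive m u n v = IsSubspace.≋-closed (supported-isSubspace _)
  (≋-sym (⟦⟧⧢⟦⟧ (+[1+ m ] ∷ u) (+[1+ n ] ∷ v)))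
  (Grid.grid-positive (firstZero u v) (secondZero u v)
    (λ b → prefix-nonNegative (u ⧢ʷ (b ∷ v)))
    (λ k → prefix-nonNegative (consProduct +[1+ k ] u v)) m n)
  where
  prefix-nonNegative : ∀ x → Supported NonNegativeHead (prefix 0ℤ x)
  prefix-nonNegative x = supported-prefix 0ℤ (λ _ _ → tt) x (λ _ ¬⊤ → contradiction tt ¬⊤)

InD-isSubspace : ∀ k → IsSubspace (InD k)
InD-isSubspace k = supported-isSubspace (λ w → depth w ≡ k)

InD-⟦⟧ : ∀ w → InD (depth w) ⟦ w ⟧
InD-⟦⟧ w w′ ≢depth = coeff-∷-≢ 1ℚ w [] w′ (λ w≡w′ → ≢depth (cong depth (sym w≡w′)))

InD-noUnit : ∀ k x → InD (suc k) x → NoUnit x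
InD-noUnit k x x∈D = x∈D [] λ ()

mutual
  ⧢ʷ-InD : ∀ u v → InD (depth u ℕ.+ depth v) (u ⧢ʷ v)
  ⧢ʷ-InD []      v = InD-⟦⟧ v
  ⧢ʷ-InD (a ∷ u) v = consProduct-InD a u v

  consProduct-InD : ∀ a u v → InD (suc (depth u) ℕ.+ depth v) (consProduct a u v)
  consProduct-InD a u [] rewrite ℕP.+-identityʳ (depth u) = InD-⟦⟧ (a ∷ u)
  consProduct-InD a u (b ∷ v) = Grid.grid-closed (firstZero u v) (secondZero u v)
    (InD-isSubspace k) J-InD raise-InD
    (λ b → prefix-InD (u ⧢ʷ (b ∷ v)) (⧢ʷ-InD u (b ∷ v)))
    (λ m → subst (λ k → InD k (secondZero u v m)) (cong suc (sym (ℕP.+-suc (depth u) (depth v))))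
             (prefix-InD (consProduct +[1+ m ] u v) (consProduct-InD +[1+ m ] u v)))
    a b
    where
    k = suc (depth u) ℕ.+ suc (depth v)
    J-InD : ∀ x → InD k x → InD k (J x)
    J-InD x rewrite J≡mapHead-dec x = supported-mapHead dec inc dec-inc inc-dec (λ _ _ d → d) x
    raise-InD : ∀ x → InD k x → InD k (raise x)
    raise-InD = supported-mapHead inc dec inc-dec dec-inc (λ _ _ d → d)
    prefix-InD : ∀ {n} x → InD n x → InD (suc n) (prefix 0ℤ x)
    prefix-InD = supported-prefix 0ℤ (λ _ d → cong suc d)

⧢-graded : ∀ n m a b → InD n a → InD m b → InD (n ℕ.+ m) (a ⧢ b)
⧢-graded n m a b a∈D b∈D = span-closed (preimage-isSubspace (⧢-isLinearˡ b) (InD-isSubspace (n ℕ.+ m)))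
  (λ w → depth w ℕ.≟ n) word a a∈D
  where
  word : ∀ u → depth u ≡ n → InD (n ℕ.+ m) (⟦ u ⟧ ⧢ b)
  word u refl = span-closed (preimage-isSubspace (⧢-isLinearʳ ⟦ u ⟧) (InD-isSubspace (n ℕ.+ m)))
    (λ w → depth w ℕ.≟ m)
    (λ { v refl → IsSubspace.≋-closed (InD-isSubspace _) (≋-sym (⟦⟧⧢⟦⟧ u v)) (⧢ʷ-InD u v) })
    b b∈D

-- Uniqueness of solutions of the Leibniz rule on ℤⁿ

Σlower : ∀ {n} → (Vec ℤ n → H) → Vec ℤ n → H
Σlower f []      = []
Σlower f (a ∷ h) = f (dec a ∷ h) ⊕ Σlower (λ h′ → f (a ∷ h′)) h

Σlower-cong : ∀ {n} {f g : Vec ℤ n → H} → (∀ h → f h ≋ g h) → ∀ h → Σlower f h ≋ Σlower g h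
Σlower-cong f≋g []      = ≋-refl
Σlower-cong f≋g (a ∷ h) = ⊕-cong (f≋g (dec a ∷ h)) (Σlower-cong (λ h′ → f≋g (a ∷ h′)) h)

OnBoundary : ∀ {n} → Vec ℤ n → Set
OnBoundary []      = ⊥
OnBoundary (a ∷ h) = a ≡ 0ℤ ⊎ (a ℤ.> 0ℤ × OnBoundary h)

record SolvesLeibniz {n} (e f : Vec ℤ n → H) : Set where
  field
    leibniz : ∀ h → J (f h) ≋ e h ⊕ Σlower f h
    noUnit  : ∀ h → All (ℤ._> 0ℤ) h → NoUnit (f h)

slice : ∀ {n} {e f : Vec ℤ (suc n) → H} → SolvesLeibniz e f → ∀ m →
        SolvesLeibniz (λ h → e (+[1+ m ] ∷ h) ⊕ f (+ m ∷ h)) (λ h → f (+[1+ m ] ∷ h))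
slice {e = e} {f} sol m = record
  { leibniz = λ h → ≋-trans (leibniz (+[1+ m ] ∷ h)) (≋-sym (⊕-assoc (e (+[1+ m ] ∷ h)) (f (+ m ∷ h)) _))
  ; noUnit  = λ h h>0 → noUnit (+[1+ m ] ∷ h) (ℤ.+<+ (ℕ.s≤s ℕ.z≤n) ∷ h>0) }
  where open SolvesLeibniz sol

-- A positive first coordinate is fixed by slicing, which is
-- why the rule carries a source term e; a negative first coordinate is
-- reached by lowering the one above it; for n = 0 the rule determines f
-- because J is injective on vectors without unit component.
leibniz-unique : ∀ {n} {e e′ f g : Vec ℤ n → H} → SolvesLeibniz e f → SolvesLeibniz e′ g →
                 (∀ h → e h ≋ e′ h) → (∀ h → OnBoundary h → f h ≋ g h) → ∀ h → f h ≋ g h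
leibniz-unique sf sg e≋e′ boundary [] =
  J-injective (noUnit sf [] []) (noUnit sg [] [])
    (≋-trans (leibniz sf []) (≋-trans (⊕-congʳ (e≋e′ [])) (≋-sym (leibniz sg []))))
  where open SolvesLeibniz
leibniz-unique {e = e} {e′} {f} {g} sf sg e≋e′ boundary (a ∷ h) = row a h
  where
  open SolvesLeibniz
  open ≋-Reasoning
  natural : ∀ m h → f (+ m ∷ h) ≋ g (+ m ∷ h)
  natural zero    h = boundary (+ 0 ∷ h) (inj₁ refl)
  natural (suc m) = leibniz-unique (slice sf m) (slice sg m)
    (λ h → ⊕-cong (e≋e′ (+[1+ m ] ∷ h)) (natural m h))
    (λ h h∈∂ → boundary (+[1+ m ] ∷ h) (inj₂ (ℤ.+<+ (ℕ.s≤s ℕ.z≤n) , h∈∂)))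
  negative : ∀ m h → f (-[1+ m ] ∷ h) ≋ g (-[1+ m ] ∷ h)
  negative m h = ∙-cancelʳ (e (a′ ∷ h) ⊕ Σlower (λ h′ → f (a′ ∷ h′)) h) _ _ (begin
      f (-[1+ m ] ∷ h) ⊕ (e (a′ ∷ h) ⊕ Σlower (λ h′ → f (a′ ∷ h′)) h)
        ≈⟨ ⊕-congʳ (≡⇒≋ (cong (λ b → f (b ∷ h)) (sym (dec-inc -[1+ m ])))) ⟩
      f (dec a′ ∷ h) ⊕ (e (a′ ∷ h) ⊕ Σlower (λ h′ → f (a′ ∷ h′)) h)
        ≈⟨ x∙yz≈y∙xz (f (dec a′ ∷ h)) (e (a′ ∷ h)) _ ⟩
      e (a′ ∷ h) ⊕ Σlower f (a′ ∷ h)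
        ≈⟨ leibniz sf (a′ ∷ h) ⟨
      J (f (a′ ∷ h))
        ≈⟨ ≋-cong J-isLinear (above m h) ⟩
      J (g (a′ ∷ h))
        ≈⟨ leibniz sg (a′ ∷ h) ⟩
      e′ (a′ ∷ h) ⊕ Σlower g (a′ ∷ h)
        ≈⟨ x∙yz≈y∙xz (e′ (a′ ∷ h)) (g (dec a′ ∷ h)) _ ⟩
      g (dec a′ ∷ h) ⊕ (e′ (a′ ∷ h) ⊕ Σlower (λ h′ → g (a′ ∷ h′)) h)
        ≈⟨ ⊕-cong (≡⇒≋ (cong (λ b → g (b ∷ h)) (dec-inc -[1+ m ])))
                  (⊕-cong (≋-sym (e≋e′ (a′ ∷ h))) (≋-sym (Σlower-cong (λ h′ → above m h′) h))) ⟩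
      g (-[1+ m ] ∷ h) ⊕ (e (a′ ∷ h) ⊕ Σlower (λ h′ → f (a′ ∷ h′)) h) ∎)
    where
    a′ = inc -[1+ m ]
    above : ∀ m h → f (inc -[1+ m ] ∷ h) ≋ g (inc -[1+ m ] ∷ h)
    above zero    = natural 0
    above (suc m) = negative m
  row : ∀ a h → f (a ∷ h) ≋ g (a ∷ h)
  row (+ m)    = natural m
  row -[1+ m ] = negative m

≋-via-prefix : ∀ {x x′ y y′} → x ≋ prefix 0ℤ y → x′ ≋ prefix 0ℤ y′ → y ≋ y′ → x ≋ x′
≋-via-prefix x≋ x′≋ y≋y′ = ≋-trans x≋ (≋-trans (≋-cong (prefix-isLinear 0ℤ) y≋y′) (≋-sym x′≋))

record ShuffleRules₂ (β : Word → Word → H) : Set where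
  field
    leibniz : ∀ a u b v → J (β (a ∷ u) (b ∷ v)) ≋ β (dec a ∷ u) (b ∷ v) ⊕ β (a ∷ u) (dec b ∷ v)
    zero₁   : ∀ u v → β (0ℤ ∷ u) v ≋ prefix 0ℤ (β u v)
    zero₂   : ∀ m u v → β (+[1+ m ] ∷ u) (0ℤ ∷ v) ≋ prefix 0ℤ (β (+[1+ m ] ∷ u) v)
    noUnit  : ∀ a u b v → NoUnit (β (a ∷ u) (b ∷ v))

  heads : Word → Word → Vec ℤ 2 → H
  heads u v (a ∷ b ∷ []) = β (a ∷ u) (b ∷ v)

  solvesLeibniz : ∀ u v → SolvesLeibniz (λ _ → []) (heads u v)
  solvesLeibniz u v = record
    { leibniz = λ { (a ∷ b ∷ []) →
        ≋-trans (leibniz a u b v) (⊕-congˡ (≋-sym (⊕-identityʳ (β (a ∷ u) (dec b ∷ v))))) }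
    ; noUnit  = λ { (a ∷ b ∷ []) _ → noUnit a u b v } }

module _ {β β′ : Word → Word → H} (R : ShuffleRules₂ β) (R′ : ShuffleRules₂ β′)
         (unitˡ : ∀ v → β [] v ≋ β′ [] v) (unitʳ : ∀ u → β u [] ≋ β′ u []) where
  open ShuffleRules₂

  mutual
    shuffleRules₂-unique : ∀ u v → β u v ≋ β′ u v
    shuffleRules₂-unique []      v = unitˡ v
    shuffleRules₂-unique (a ∷ u) v = cons-unique a u v

    private
      cons-unique : ∀ a u v → β (a ∷ u) v ≋ β′ (a ∷ u) v
      cons-unique a u []      = unitʳ (a ∷ u)
      cons-unique a u (b ∷ v) =
        leibniz-unique (solvesLeibniz R u v) (solvesLeibniz R′ u v) (λ _ → ≋-refl) boundary (a ∷ b ∷ [])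
        where
        boundary : ∀ h → OnBoundary h → heads R u v h ≋ heads R′ u v h
        boundary (_ ∷ b ∷ []) (inj₁ refl) =
          ≋-via-prefix (zero₁ R u (b ∷ v)) (zero₁ R′ u (b ∷ v)) (shuffleRules₂-unique u (b ∷ v))
        boundary (+[1+ m ] ∷ _ ∷ []) (inj₂ (_ , inj₁ refl)) =
          ≋-via-prefix (zero₂ R m u v) (zero₂ R′ m u v) (cons-unique +[1+ m ] u v)
        boundary (+ 0 ∷ _ ∷ []) (inj₂ (ℤ.+<+ () , _))
        boundary (_ ∷ _ ∷ []) (inj₂ (_ , inj₂ (_ , ())))

record ShuffleRules₃ (τ : Word → Word → Word → H) : Set where
  field
    leibniz : ∀ a u b v c w → J (τ (a ∷ u) (b ∷ v) (c ∷ w)) ≋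
              τ (dec a ∷ u) (b ∷ v) (c ∷ w) ⊕ (τ (a ∷ u) (dec b ∷ v) (c ∷ w) ⊕ τ (a ∷ u) (b ∷ v) (dec c ∷ w))
    zero₁   : ∀ u v w → τ (0ℤ ∷ u) v w ≋ prefix 0ℤ (τ u v w)
    zero₂   : ∀ m u v w → τ (+[1+ m ] ∷ u) (0ℤ ∷ v) w ≋ prefix 0ℤ (τ (+[1+ m ] ∷ u) v w)
    zero₃   : ∀ m u n v w → τ (+[1+ m ] ∷ u) (+[1+ n ] ∷ v) (0ℤ ∷ w) ≋
                            prefix 0ℤ (τ (+[1+ m ] ∷ u) (+[1+ n ] ∷ v) w)
    noUnit  : ∀ a u b v c w → NoUnit (τ (a ∷ u) (b ∷ v) (c ∷ w))

  heads : Word → Word → Word → Vec ℤ 3 → H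
  heads u v w (a ∷ b ∷ c ∷ []) = τ (a ∷ u) (b ∷ v) (c ∷ w)

  solvesLeibniz : ∀ u v w → SolvesLeibniz (λ _ → []) (heads u v w)
  solvesLeibniz u v w = record
    { leibniz = λ { (a ∷ b ∷ c ∷ []) → ≋-trans (leibniz a u b v c w)
        (⊕-congˡ {τ (dec a ∷ u) (b ∷ v) (c ∷ w)} (⊕-congˡ {τ (a ∷ u) (dec b ∷ v) (c ∷ w)}
          (≋-sym (⊕-identityʳ (τ (a ∷ u) (b ∷ v) (dec c ∷ w)))))) }
    ; noUnit  = λ { (a ∷ b ∷ c ∷ []) _ → noUnit a u b v c w } }

module _ {τ τ′ : Word → Word → Word → H} (T : ShuffleRules₃ τ) (T′ : ShuffleRules₃ τ′)
         (unit₁ : ∀ v w → τ [] v w ≋ τ′ [] v w) (unit₂ : ∀ u w → τ u [] w ≋ τ′ u [] w)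
         (unit₃ : ∀ u v → τ u v [] ≋ τ′ u v []) where
  open ShuffleRules₃

  mutual
    shuffleRules₃-unique : ∀ u v w → τ u v w ≋ τ′ u v w
    shuffleRules₃-unique []      v w = unit₁ v w
    shuffleRules₃-unique (a ∷ u) v w = cons-unique a u v w

    private
      cons-unique : ∀ a u v w → τ (a ∷ u) v w ≋ τ′ (a ∷ u) v w
      cons-unique a u []      w = unit₂ (a ∷ u) w
      cons-unique a u (b ∷ v) w = cons-cons-unique a u b v w

      cons-cons-unique : ∀ a u b v w → τ (a ∷ u) (b ∷ v) w ≋ τ′ (a ∷ u) (b ∷ v) w
      cons-cons-unique a u b v []      = unit₃ (a ∷ u) (b ∷ v)
      cons-cons-unique a u b v (c ∷ w) =
        leibniz-unique (solvesLeibniz T u v w) (solvesLeibniz T′ u v w) (λ _ → ≋-refl) boundary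
          (a ∷ b ∷ c ∷ [])
        where
        boundary : ∀ h → OnBoundary h → heads T u v w h ≋ heads T′ u v w h
        boundary (_ ∷ b ∷ c ∷ []) (inj₁ refl) =
          ≋-via-prefix (zero₁ T u (b ∷ v) (c ∷ w)) (zero₁ T′ u (b ∷ v) (c ∷ w))
                       (shuffleRules₃-unique u (b ∷ v) (c ∷ w))
        boundary (+[1+ m ] ∷ _ ∷ c ∷ []) (inj₂ (_ , inj₁ refl)) =
          ≋-via-prefix (zero₂ T m u v (c ∷ w)) (zero₂ T′ m u v (c ∷ w)) (cons-unique +[1+ m ] u v (c ∷ w))
        boundary (+[1+ m ] ∷ +[1+ n ] ∷ _ ∷ []) (inj₂ (_ , inj₂ (_ , inj₁ refl))) =
          ≋-via-prefix (zero₃ T m u n v w) (zero₃ T′ m u n v w) (cons-cons-unique +[1+ m ] u +[1+ n ] v w)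
        boundary (+ 0 ∷ _) (inj₂ (ℤ.+<+ () , _))
        boundary (_ ∷ + 0 ∷ _) (inj₂ (_ , inj₂ (ℤ.+<+ () , _)))
        boundary (_ ∷ _ ∷ _ ∷ []) (inj₂ (_ , inj₂ (_ , inj₂ (_ , ()))))

-- Associativity

⧢-leibniz₃ˡ : ∀ x y z → J ((x ⧢ y) ⧢ z) ≋ (J x ⧢ y) ⧢ z ⊕ ((x ⧢ J y) ⧢ z ⊕ (x ⧢ y) ⧢ J z)
⧢-leibniz₃ˡ x y z = begin
  J ((x ⧢ y) ⧢ z)                                       ≈⟨ ⧢-leibniz (x ⧢ y) z ⟩
  J (x ⧢ y) ⧢ z ⊕ (x ⧢ y) ⧢ J z                         ≈⟨ ⊕-congʳ (⧢-congˡ z (⧢-leibniz x y)) ⟩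
  (J x ⧢ y ⊕ x ⧢ J y) ⧢ z ⊕ (x ⧢ y) ⧢ J z
    ≈⟨ ⊕-congʳ (⊕-homo (⧢-isLinearˡ z) (J x ⧢ y) (x ⧢ J y)) ⟩
  ((J x ⧢ y) ⧢ z ⊕ (x ⧢ J y) ⧢ z) ⊕ (x ⧢ y) ⧢ J z       ≈⟨ ⊕-assoc ((J x ⧢ y) ⧢ z) ((x ⧢ J y) ⧢ z) _ ⟩
  (J x ⧢ y) ⧢ z ⊕ ((x ⧢ J y) ⧢ z ⊕ (x ⧢ y) ⧢ J z)       ∎
  where open ≋-Reasoning

⧢-leibniz₃ʳ : ∀ x y z → J (x ⧢ (y ⧢ z)) ≋ J x ⧢ (y ⧢ z) ⊕ (x ⧢ (J y ⧢ z) ⊕ x ⧢ (y ⧢ J z))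
⧢-leibniz₃ʳ x y z = begin
  J (x ⧢ (y ⧢ z))                                       ≈⟨ ⧢-leibniz x (y ⧢ z) ⟩
  J x ⧢ (y ⧢ z) ⊕ x ⧢ J (y ⧢ z)                         ≈⟨ ⊕-congˡ (⧢-congʳ x (⧢-leibniz y z)) ⟩
  J x ⧢ (y ⧢ z) ⊕ x ⧢ (J y ⧢ z ⊕ y ⧢ J z)
    ≈⟨ ⊕-congˡ (⊕-homo (⧢-isLinearʳ x) (J y ⧢ z) (y ⧢ J z)) ⟩
  J x ⧢ (y ⧢ z) ⊕ (x ⧢ (J y ⧢ z) ⊕ x ⧢ (y ⧢ J z))       ∎
  where open ≋-Reasoning

⟦⟧-positive : ∀ m u → Supported PositiveHead ⟦ +[1+ m ] ∷ u ⟧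
⟦⟧-positive m u w ¬pw = coeff-∷-≢ 1ℚ (+[1+ m ] ∷ u) [] w λ { refl → ¬pw tt }

⟦⟧⧢⟦⟧-InD : ∀ u v → InD (depth u ℕ.+ depth v) (⟦ u ⟧ ⧢ ⟦ v ⟧)
⟦⟧⧢⟦⟧-InD u v = ⧢-graded _ _ ⟦ u ⟧ ⟦ v ⟧ (InD-⟦⟧ u) (InD-⟦⟧ v)

leftBracket rightBracket : Word → Word → Word → H
leftBracket  u v w = (⟦ u ⟧ ⧢ ⟦ v ⟧) ⧢ ⟦ w ⟧
rightBracket u v w = ⟦ u ⟧ ⧢ (⟦ v ⟧ ⧢ ⟦ w ⟧)

leftBracket-rules : ShuffleRules₃ leftBracket
leftBracket-rules = record
  { leibniz = λ a u b v c w → ⧢-leibniz₃ˡ ⟦ a ∷ u ⟧ ⟦ b ∷ v ⟧ ⟦ c ∷ w ⟧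
  ; zero₁   = λ u v w → ≋-trans (⧢-congˡ ⟦ w ⟧ (prefix-⧢ ⟦ u ⟧ ⟦ v ⟧)) (prefix-⧢ (⟦ u ⟧ ⧢ ⟦ v ⟧) ⟦ w ⟧)
  ; zero₂   = λ m u v w → ≋-trans (⧢-congˡ ⟦ w ⟧ (⧢-prefix ⟦ +[1+ m ] ∷ u ⟧ ⟦ v ⟧ (⟦⟧-positive m u)))
                                   (prefix-⧢ (⟦ +[1+ m ] ∷ u ⟧ ⧢ ⟦ v ⟧) ⟦ w ⟧)
  ; zero₃   = λ m u n v w → ⧢-prefix (⟦ +[1+ m ] ∷ u ⟧ ⧢ ⟦ +[1+ n ] ∷ v ⟧) ⟦ w ⟧ (⧢-positive m u n v)
  ; noUnit  = λ a u b v c w → InD-noUnit _ (leftBracket (a ∷ u) (b ∷ v) (c ∷ w))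
      (⧢-graded _ _ (⟦ a ∷ u ⟧ ⧢ ⟦ b ∷ v ⟧) ⟦ c ∷ w ⟧ (⟦⟧⧢⟦⟧-InD (a ∷ u) (b ∷ v)) (InD-⟦⟧ (c ∷ w))) }

rightBracket-rules : ShuffleRules₃ rightBracket
rightBracket-rules = record
  { leibniz = λ a u b v c w → ⧢-leibniz₃ʳ ⟦ a ∷ u ⟧ ⟦ b ∷ v ⟧ ⟦ c ∷ w ⟧
  ; zero₁   = λ u v w → prefix-⧢ ⟦ u ⟧ (⟦ v ⟧ ⧢ ⟦ w ⟧)
  ; zero₂   = λ m u v w → ≋-trans (⧢-congʳ ⟦ +[1+ m ] ∷ u ⟧ (prefix-⧢ ⟦ v ⟧ ⟦ w ⟧))
                                   (⧢-prefix ⟦ +[1+ m ] ∷ u ⟧ (⟦ v ⟧ ⧢ ⟦ w ⟧) (⟦⟧-positive m u))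
  ; zero₃   = λ m u n v w → ≋-trans
      (⧢-congʳ ⟦ +[1+ m ] ∷ u ⟧ (⧢-prefix ⟦ +[1+ n ] ∷ v ⟧ ⟦ w ⟧ (⟦⟧-positive n v)))
      (⧢-prefix ⟦ +[1+ m ] ∷ u ⟧ (⟦ +[1+ n ] ∷ v ⟧ ⧢ ⟦ w ⟧) (⟦⟧-positive m u))
  ; noUnit  = λ a u b v c w → InD-noUnit _ (rightBracket (a ∷ u) (b ∷ v) (c ∷ w))
      (⧢-graded _ _ ⟦ a ∷ u ⟧ (⟦ b ∷ v ⟧ ⧢ ⟦ c ∷ w ⟧) (InD-⟦⟧ (a ∷ u)) (⟦⟧⧢⟦⟧-InD (b ∷ v) (c ∷ w))) }

⧢-assoc : ∀ x y z → (x ⧢ y) ⧢ z ≋ x ⧢ (y ⧢ z)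
⧢-assoc x y z = linear-unique
  (∘-isLinear (⧢-isLinearˡ z) (⧢-isLinearˡ y)) (⧢-isLinearˡ (y ⧢ z))
  (λ u → linear-unique
     (∘-isLinear (⧢-isLinearˡ z) (⧢-isLinearʳ ⟦ u ⟧)) (∘-isLinear (⧢-isLinearʳ ⟦ u ⟧) (⧢-isLinearˡ z))
     (λ v → linear-unique
        (⧢-isLinearʳ (⟦ u ⟧ ⧢ ⟦ v ⟧)) (∘-isLinear (⧢-isLinearʳ ⟦ u ⟧) (⧢-isLinearʳ ⟦ v ⟧))
        (shuffleRules₃-unique leftBracket-rules rightBracket-rules
           (λ v w → ≋-trans (⧢-congˡ ⟦ w ⟧ (⧢-identityˡ ⟦ v ⟧)) (≋-sym (⧢-identityˡ (⟦ v ⟧ ⧢ ⟦ w ⟧))))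
           (λ u w → ≋-trans (⧢-congˡ ⟦ w ⟧ (⧢-identityʳ ⟦ u ⟧))
                             (⧢-congʳ ⟦ u ⟧ (≋-sym (⧢-identityˡ ⟦ w ⟧))))
           (λ u v → ≋-trans (⧢-identityʳ (⟦ u ⟧ ⧢ ⟦ v ⟧)) (⧢-congʳ ⟦ u ⟧ (≋-sym (⧢-identityʳ ⟦ v ⟧))))
           u v)
        z)
     y)
  x

⧢-isProduct : IsProduct _⧢_
⧢-isProduct = record
  { ⧢-cong    = λ {a} {a′} {b} {b′} a≈a′ b≈b′ →
      coeff-≡ (≋-trans (⧢-congˡ b {a} {a′} (pointwise a≈a′)) (⧢-congʳ a′ {b} {b′} (pointwise b≈b′)))
  ; ⧢-addˡ    = λ a a′ b → coeff-≡ (⊕-homo (⧢-isLinearˡ b) a a′)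
  ; ⧢-addʳ    = λ a b b′ → coeff-≡ (⊕-homo (⧢-isLinearʳ a) b b′)
  ; ⧢-scaleˡ  = λ c a b → coeff-≡ (·-homo (⧢-isLinearˡ b) c a)
  ; ⧢-scaleʳ  = λ c a b → coeff-≡ (·-homo (⧢-isLinearʳ a) c b)
  ; ⧢-assoc   = λ a b c → coeff-≡ (⧢-assoc a b c)
  ; ⧢-graded  = ⧢-graded
  ; ⧢-unitˡ   = λ a → coeff-≡ (⧢-identityˡ a)
  ; ⧢-unitʳ   = λ a → coeff-≡ (⧢-identityʳ a)
  ; ⧢-zeroˡ   = λ s ss → coeff-≡ (⟦⟧⧢⟦⟧ (0ℤ ∷ []) (s ∷ ss))
  ; ⧢-zeroʳ   = λ where
      +[1+ m ] ss _ → coeff-≡ (⟦⟧⧢⟦⟧ (+[1+ m ] ∷ ss) (0ℤ ∷ []))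
      (+ 0)    ss (ℤ.+<+ ())
  ; J-leibniz = λ a b → coeff-≡ (⧢-leibniz a b) }

module _ {p : H → H → H} (isProduct : IsProduct p) where
  private module P = IsProduct isProduct

  isProduct-isLinearˡ : ∀ y → IsLinear (λ x → p x y)
  isProduct-isLinearˡ y = record
    { ≋-cong = λ (pointwise x≈x′) → pointwise (P.⧢-cong x≈x′ λ _ → refl)
    ; ⊕-homo = λ x x′ → pointwise (P.⧢-addˡ x x′ y)
    ; ·-homo = λ c x → pointwise (P.⧢-scaleˡ c x y) }

  isProduct-isLinearʳ : ∀ x → IsLinear (p x)
  isProduct-isLinearʳ x = record
    { ≋-cong = λ (pointwise y≈y′) → pointwise (P.⧢-cong (λ _ → refl) y≈y′)
    ; ⊕-homo = λ y y′ → pointwise (P.⧢-addʳ x y y′)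
    ; ·-homo = λ c y → pointwise (P.⧢-scaleʳ c x y) }

  ⟦0⟧-prefix : ∀ z → p ⟦ 0ℤ ∷ [] ⟧ z ≋ prefix 0ℤ z
  ⟦0⟧-prefix = linear-unique (isProduct-isLinearʳ ⟦ 0ℤ ∷ [] ⟧) (prefix-isLinear 0ℤ) λ where
    []       → pointwise (P.⧢-unitʳ ⟦ 0ℤ ∷ [] ⟧)
    (s ∷ ss) → pointwise (P.⧢-zeroˡ s ss)

  isProduct⇒shuffleRules₂ : ShuffleRules₂ (λ u v → p ⟦ u ⟧ ⟦ v ⟧)
  isProduct⇒shuffleRules₂ = record
    { leibniz = λ a u b v → pointwise (P.J-leibniz ⟦ a ∷ u ⟧ ⟦ b ∷ v ⟧)
    ; zero₁   = zero₁
    ; zero₂   = λ m u v → begin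
        p ⟦ +[1+ m ] ∷ u ⟧ ⟦ 0ℤ ∷ v ⟧
          ≈⟨ ≋-cong (isProduct-isLinearʳ _) (⟦0⟧-prefix ⟦ v ⟧) ⟨
        p ⟦ +[1+ m ] ∷ u ⟧ (p ⟦ 0ℤ ∷ [] ⟧ ⟦ v ⟧)
          ≈⟨ pointwise (P.⧢-assoc _ _ _) ⟨
        p (p ⟦ +[1+ m ] ∷ u ⟧ ⟦ 0ℤ ∷ [] ⟧) ⟦ v ⟧
          ≈⟨ ≋-cong (isProduct-isLinearˡ ⟦ v ⟧) (pointwise (P.⧢-zeroʳ +[1+ m ] u (ℤ.+<+ (ℕ.s≤s ℕ.z≤n)))) ⟩
        p ⟦ 0ℤ ∷ +[1+ m ] ∷ u ⟧ ⟦ v ⟧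
          ≈⟨ zero₁ (+[1+ m ] ∷ u) v ⟩
        prefix 0ℤ (p ⟦ +[1+ m ] ∷ u ⟧ ⟦ v ⟧) ∎
    ; noUnit  = λ a u b v → InD-noUnit _ (p ⟦ a ∷ u ⟧ ⟦ b ∷ v ⟧)
        (P.⧢-graded _ _ ⟦ a ∷ u ⟧ ⟦ b ∷ v ⟧ (InD-⟦⟧ (a ∷ u)) (InD-⟦⟧ (b ∷ v))) }
    where
    open ≋-Reasoning
    zero₁ : ∀ u v → p ⟦ 0ℤ ∷ u ⟧ ⟦ v ⟧ ≋ prefix 0ℤ (p ⟦ u ⟧ ⟦ v ⟧)
    zero₁ u v = begin
      p ⟦ 0ℤ ∷ u ⟧ ⟦ v ⟧                   ≈⟨ ≋-cong (isProduct-isLinearˡ ⟦ v ⟧) (⟦0⟧-prefix ⟦ u ⟧) ⟨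
      p (p ⟦ 0ℤ ∷ [] ⟧ ⟦ u ⟧) ⟦ v ⟧        ≈⟨ pointwise (P.⧢-assoc _ _ _) ⟩
      p ⟦ 0ℤ ∷ [] ⟧ (p ⟦ u ⟧ ⟦ v ⟧)        ≈⟨ ⟦0⟧-prefix (p ⟦ u ⟧ ⟦ v ⟧) ⟩
      prefix 0ℤ (p ⟦ u ⟧ ⟦ v ⟧)            ∎

isProduct-unique : ∀ {p q} → IsProduct p → IsProduct q → ∀ a b → p a b ≋ q a b
isProduct-unique P Q a b = linear-unique (isProduct-isLinearˡ P b) (isProduct-isLinearˡ Q b)
  (λ u → linear-unique (isProduct-isLinearʳ P ⟦ u ⟧) (isProduct-isLinearʳ Q ⟦ u ⟧)
     (shuffleRules₂-unique (isProduct⇒shuffleRules₂ P) (isProduct⇒shuffleRules₂ Q)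
        (λ v → pointwise λ w → trans (IsProduct.⧢-unitˡ P ⟦ v ⟧ w) (sym (IsProduct.⧢-unitˡ Q ⟦ v ⟧ w)))
        (λ u → pointwise λ w → trans (IsProduct.⧢-unitʳ P ⟦ u ⟧ w) (sym (IsProduct.⧢-unitʳ Q ⟦ u ⟧ w)))
        u)
     b)
  a

theorem2p5 : Σ (H → H → H) IsProduct
    × (∀ (p q : H → H → H) → IsProduct p → IsProduct q → ∀ a b → p a b ≈ q a b)
theorem2p5 = (_⧢_ , ⧢-isProduct) , λ p q P Q a b → coeff-≡ (isProduct-unique P Q a b)
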